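{- The following are equivalent: (i) $\mathcal{V}$ admits right uniform deductive interpolation. (ii) $\mathcal{V}$ admits deductive interpolation, and the compact lifting of any homomorphism between finitely presented algebras in $\mathcal{V}$ has a right adjoint.
   Context: Fix an algebraic signature $\mathcal{L}$ containing at least one constant symbol and a variety $\mathcal{V}$ of $\mathcal{L}$-algebras. For a set of variables $\overline{x}$, $\mathbf{F}(\overline{x})$ is the free algebra of $\mathcal{V}$ on $\overline{x}$. Distinct letters $\overline{x},\overline{y},\overline{z}$ denote pairwise disjoint sets of variables, and $\overline{x},\overline{y}$ denotes their disjoint union. An equation is a pair of terms $\alpha\approx\beta$; $\Sigma(\overline{x})$ (resp. $\varepsilon(\overline{x})$) means all variables occurring in the set of equations $\Sigma$ (resp. the equation $\varepsilon$) lie in $\overline{x}$. For sets of equations $\Sigma,\Delta$, $\Sigma\models_{\mathcal V}\Delta$ means: for every $\mathbf A\in\mathcal V$ and every assignment of the variables into $A$, if all equations of $\Sigma$ hold then all equations of $\Delta$ hold. $\mathcal V$ admits deductive interpolation if for any finite sets $\overline{x},\overline{y},\overline{z}$ and finite set of equations $\Sigma(\overline{x},\overline{y})$ and equation $\varepsilon(\overline{y},\overline{z})$ with $\Sigma\models_{\mathcal V}\varepsilon$, there is a finite set of equations $\Pi(\overline{y})$ with $\Sigma\models_{\mathcal V}\Pi$ and $\Pi\models_{\mathcal V}\varepsilon$. $\mathcal V$ admits right uniform deductive interpolation if for any finite sets $\overline{x},\overline{y}$ and finite set of equations $\Sigma(\overline{x},\overline{y})$ there is a finite set of equations $\Pi(\overline{y})$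 such that $\Sigma\models_{\mathcal V}\Pi$ and, for any equation $\varepsilon(\overline{y},\overline{z})$, $\Sigma\models_{\mathcal V}\varepsilon$ implies $\Pi\models_{\mathcal V}\varepsilon$. For an algebra $\mathbf A$, $\mathrm{KCon}\,\mathbf A$ denotes the join-semilattice of compact (finitely generated) congruences of $\mathbf A$ ordered by inclusion. For a homomorphism $h\colon\mathbf A\to\mathbf B$, $h^*$ sends a congruence $\psi$ of $\mathbf A$ to the congruence of $\mathbf B$ generated by $\{(h(a),h(a')):(a,a')\in\psi\}$; it maps compact congruences to compact ones, and its restriction $\mathrm{KCon}\,\mathbf A\to\mathrm{KCon}\,\mathbf B$ is called the compact lifting of $h$. A map $f\colon P\to Q$ between posets has a right adjoint $g\colon Q\to P$ if $f(a)\le b \iff a\le g(b)$ for all $a\in P,b\in Q$ (left adjoints analogously). A finite presentation of $\mathbf A$ is a surjective homomorphism $p\colon\mathbf F(\overline{x})\to\mathbf A$ with $\overline{x}$ finite and $\ker p$ a compact congruence; $\mathbf A$ is finitely presented if it has one. -}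

module Defs where

open import Level using (Level; 0ℓ) renaming (suc to lsuc)
open import Data.Nat using (ℕ)
open import Data.Fin using (Fin)
open import Data.Product using (Σ; Σ-syntax; ∃; _×_; _,_; proj₁; proj₂)
open import Data.Sum using (_⊎_; inj₁; inj₂; [_,_])
open import Data.List using (List; map)
import Data.List
open import Data.List.Relation.Unary.All using (All)
open import Data.List.Membership.Propositional using (_∈_)
open import Relation.Binary using (Rel; IsEquivalence; _⇒_)
open import Relation.Binary.PropositionalEquality using (_≡_)
open import Function using (_∘_)
open import Function.Bundles using (_⇔_)

record Signature : Set₁ where
  field
    Op    : Set
    arity : Op → ℕ

HasConstant : Signature → Set
HasConstant S = Σ[ c ∈ Signature.Op S ] Signature.arity S c ≡ 0

module _ (S : Signature) where
  open Signature S

  data Term (X : Set) : Set where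
    var : X → Term X
    app : (f : Op) → (Fin (arity f) → Term X) → Term X

  subst : {X Y : Set} → (X → Term Y) → Term X → Term Y
  subst σ (var x)    = σ x
  subst σ (app f ts) = app f (λ i → subst σ (ts i))

  rename : {X Y : Set} → (X → Y) → Term X → Term Y
  rename r = subst (var ∘ r)

  Equation : Set → Set
  Equation X = Term X × Term X

  renameEq : {X Y : Set} → (X → Y) → Equation X → Equation Y
  renameEq r (α , β) = rename r α , rename r β

  record Algebra : Set₁ where
    field
      Carrier : Set
      _≈_     : Rel Carrier 0ℓ
      isEquiv : IsEquivalence _≈_
      ⟦_⟧     : (f : Op) → (Fin (arity f) → Carrier) → Carrier
      ⟦⟧-cong : (f : Op) {as bs : Fin (arity f) → Carrier} →
                (∀ i → as i ≈ bs i) → ⟦ f ⟧ as ≈ ⟦ f ⟧ bs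

  open Algebra public

  eval : (A : Algebra) {X : Set} → (X → Carrier A) → Term X → Carrier A
  eval A ρ (var x)    = ρ x
  eval A ρ (app f ts) = ⟦ A ⟧ f (λ i → eval A ρ (ts i))

  Holds : (A : Algebra) {X : Set} → (X → Carrier A) → Equation X → Set
  Holds A ρ (α , β) = _≈_ A (eval A ρ α) (eval A ρ β)

  record Hom (A B : Algebra) : Set where
    field
      fun      : Carrier A → Carrier B
      fun-cong : ∀ {a a'} → _≈_ A a a' → _≈_ B (fun a) (fun a')
      homo     : (f : Op) (as : Fin (arity f) → Carrier A) →
                 _≈_ B (fun (⟦ A ⟧ f as)) (⟦ B ⟧ f (fun ∘ as))

  open Hom public

  data Cg (A : Algebra) (R : Rel (Carrier A) 0ℓ) : Rel (Carrier A) 0ℓ where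
    gen   : ∀ {a b} → R a b → Cg A R a b
    eq    : ∀ {a b} → _≈_ A a b → Cg A R a b
    sym   : ∀ {a b} → Cg A R a b → Cg A R b a
    trans : ∀ {a b c} → Cg A R a b → Cg A R b c → Cg A R a c
    cong  : (f : Op) {as bs : Fin (arity f) → Carrier A} →
            (∀ i → Cg A R (as i) (bs i)) → Cg A R (⟦ A ⟧ f as) (⟦ A ⟧ f bs)

  -- compact (finitely generated) congruences, represented by a finite
  -- list of generating pairs; KCon A is ordered by inclusion
  KCon : Algebra → Set
  KCon A = List (Carrier A × Carrier A)

  CgL : (A : Algebra) → KCon A → Rel (Carrier A) 0ℓ
  CgL A L = Cg A (λ a b → (a , b) ∈ L)

  KLe : (A : Algebra) → KCon A → KCon A → Set
  KLe A L M = CgL A L ⇒ CgL A M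

  data Img {A B : Algebra} (h : Hom A B) (ψ : Rel (Carrier A) 0ℓ)
           : Rel (Carrier B) 0ℓ where
    img : ∀ {a a'} → ψ a a' → Img h ψ (fun h a) (fun h a')

  lift* : {A B : Algebra} → Hom A B → Rel (Carrier A) 0ℓ → Rel (Carrier B) 0ℓ
  lift* {B = B} h ψ = Cg B (Img h ψ)

  CompactLiftingHasRightAdjoint : {A B : Algebra} → Hom A B → Set
  CompactLiftingHasRightAdjoint {A} {B} h =
    Σ[ g ∈ (KCon B → KCon A) ]
      (∀ (L : KCon A) (M : KCon B) →
         (lift* h (CgL A L) ⇒ CgL B M) ⇔ KLe A L (g M))

module _ {S : Signature} where
  open Signature S

  -- Varieties, presented by a set of identities (Birkhoff)

  record Variety : Set₁ where
    field
      Ax  : Set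
      law : Ax → Equation S ℕ

  open Variety public

  _∈V_ : Algebra S → Variety → Set
  A ∈V V = (a : Ax V) (ρ : ℕ → Carrier A) → Holds S A ρ (law V a)

  ⊨ : (V : Variety) {X : Set} → List (Equation S X) → List (Equation S X) → Set₁
  ⊨ V {X} Σ' Δ = (A : Algebra S) → A ∈V V → (ρ : X → Carrier A) →
                 All (Holds S A ρ) Σ' → All (Holds S A ρ) Δ

  -- Free algebra F(X) of V: terms modulo equational consequence of the
  -- identities of V (the fully invariant congruence they generate)

  data Derivable (V : Variety) {X : Set} : Rel (Term S X) 0ℓ where
    refl  : ∀ {t} → Derivable V t t
    sym   : ∀ {t s} → Derivable V t s → Derivable V s t
    trans : ∀ {t s u} → Derivable V t s → Derivable V s u → Derivable V t u
    cong  : (f : Op) {ts ss : Fin (arity f) → Term S X} →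
            (∀ i → Derivable V (ts i) (ss i)) →
            Derivable V (app f ts) (app f ss)
    axiom : (a : Ax V) (σ : ℕ → Term S X) →
            Derivable V (subst S σ (proj₁ (law V a))) (subst S σ (proj₂ (law V a)))

  F : (V : Variety) → Set → Algebra S
  F V X = record
    { Carrier = Term S X
    ; _≈_     = Derivable V
    ; isEquiv = record { refl = refl ; sym = sym ; trans = trans }
    ; ⟦_⟧     = app
    ; ⟦⟧-cong = cong
    }

  ker : {A B : Algebra S} → Hom S A B → Rel (Carrier A) 0ℓ
  ker {B = B} p a a' = _≈_ B (fun p a) (fun p a')

  Surjective : {A B : Algebra S} → Hom S A B → Set
  Surjective {A} {B} p = (b : Carrier B) → Σ[ a ∈ Carrier A ] _≈_ B (fun p a) b

  IsCompact : (A : Algebra S) → Rel (Carrier A) 0ℓ → Set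
  IsCompact A ψ = Σ[ L ∈ KCon S A ] (∀ a a' → ψ a a' ⇔ CgL S A L a a')

  FinitePresentation : Variety → ℕ → Algebra S → Set
  FinitePresentation V n A =
    Σ[ p ∈ Hom S (F V (Fin n)) A ] (Surjective p × IsCompact (F V (Fin n)) (ker p))

  FinitelyPresented : Variety → Algebra S → Set
  FinitelyPresented V A = Σ[ n ∈ ℕ ] FinitePresentation V n A

  -- Interpolation properties; variables x = Fin n, y = Fin m, z = Fin k

  module _ (V : Variety) where

    DeductiveInterpolation : Set₁
    DeductiveInterpolation =
      (n m k : ℕ) (Σ' : List (Equation S (Fin n ⊎ Fin m)))
      (ε : Equation S (Fin m ⊎ Fin k)) →
      -- Σ(x,y) ⊨ ε(y,z), variables x,y,z
      ⊨ V {(Fin n ⊎ Fin m) ⊎ Fin k}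
          (map (renameEq S inj₁) Σ')
          (renameEq S [ inj₁ ∘ inj₂ , inj₂ ] ε Data.List.∷ Data.List.[]) →
      Σ[ Π ∈ List (Equation S (Fin m)) ]
        ( ⊨ V {Fin n ⊎ Fin m} Σ' (map (renameEq S inj₂) Π)
        × ⊨ V {Fin m ⊎ Fin k} (map (renameEq S inj₁) Π) (ε Data.List.∷ Data.List.[]) )

    RightUniformDeductiveInterpolation : Set₁
    RightUniformDeductiveInterpolation =
      (n m : ℕ) (Σ' : List (Equation S (Fin n ⊎ Fin m))) →
      Σ[ Π ∈ List (Equation S (Fin m)) ]
        ( ⊨ V {Fin n ⊎ Fin m} Σ' (map (renameEq S inj₂) Π)
        × ((k : ℕ) (ε : Equation S (Fin m ⊎ Fin k)) →
             ⊨ V {(Fin n ⊎ Fin m) ⊎ Fin k}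
                 (map (renameEq S inj₁) Σ')
                 (renameEq S [ inj₁ ∘ inj₂ , inj₂ ] ε Data.List.∷ Data.List.[]) →
             ⊨ V {Fin m ⊎ Fin k} (map (renameEq S inj₁) Π) (ε Data.List.∷ Data.List.[])) )

    CompactLiftingsHaveRightAdjoints : Set₁
    CompactLiftingsHaveRightAdjoints =
      (A B : Algebra S) → A ∈V V → B ∈V V →
      FinitelyPresented V A → FinitelyPresented V B →
      (h : Hom S A B) → CompactLiftingHasRightAdjoint S h

-- A right uniform interpolant of Σ(x, y) is a finite Π(y) whose consequences are
-- exactly the y-consequences of Σ, i.e. Cg Π is the kernel of F(y) → F(x, y)/Σ.
-- A right adjoint g of a compact lifting h* satisfies L ≤ g Δ iff h* L = Δ, so g Δ
-- generates the kernel of h; for F(y) → F(x, y)/Σ this is a uniform interpolant, and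
-- deductive interpolation then accounts for the extra variables z.  Conversely, if
-- B is presented by generators y and relations, the kernel of k : F(x) → B consists
-- of the x-consequences of "the relations of B, and x ≈ a word in y for k x", so
-- uniform interpolation makes it compact.  For h : A → B between finitely presented
-- algebras, applied to F(x) ↠ A → B → B/M this makes h⁻¹(Cg M) compact, and compact
-- preimages are precisely a right adjoint of h*.
module Submission where

open import Defs
open import Data.Product using (_×_)
open import Function.Bundles using (_⇔_)

open import Level using (0ℓ)
open import Data.Nat using (ℕ; _+_)
open import Data.Fin using (Fin; splitAt; join)
open import Data.Fin.Properties using (splitAt-join)
open import Data.Product using (Σ-syntax; _,_; proj₁; proj₂)
open import Data.Sum using (_⊎_; inj₁; inj₂; [_,_])
open import Data.List using (List; []; _∷_; map; _++_; allFin)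
open import Data.List.Relation.Unary.All as All using (All; []; _∷_)
import Data.List.Relation.Unary.All.Properties as All
open import Data.List.Relation.Unary.Any using (here)
open import Data.List.Membership.Propositional using (_∈_)
open import Data.List.Membership.Propositional.Properties
  using (∈-map⁺; ∈-map⁻; ∈-++⁻; ∈-allFin)
open import Relation.Binary using (Rel; Setoid; IsEquivalence; _⇒_)
import Relation.Binary.PropositionalEquality as ≡
import Relation.Binary.Reasoning.Setoid as SetoidReasoning
open import Function using (_∘_; id)
open import Function.Bundles using (mk⇔; Equivalence)
import Function.Properties.Equivalence as ⇔

module _ {S : Signature} where
  open Signature S

  setoid : Algebra S → Setoid 0ℓ 0ℓ
  setoid A = record { isEquivalence = isEquiv A }

  module ≈-Reasoning (A : Algebra S) = SetoidReasoning (setoid A)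

  module _ (A : Algebra S) where
    open IsEquivalence (isEquiv A) public
      using ()
      renaming (refl to ≈-refl; sym to ≈-sym; trans to ≈-trans; reflexive to ≈-reflexive)

  eval-cong : (A : Algebra S) {X : Set} {ρ ρ' : X → Carrier A} →
    (∀ x → _≈_ A (ρ x) (ρ' x)) → (t : Term S X) → _≈_ A (eval S A ρ t) (eval S A ρ' t)
  eval-cong A ρ≈ρ' (var x)    = ρ≈ρ' x
  eval-cong A ρ≈ρ' (app f ts) = ⟦⟧-cong A f (λ i → eval-cong A ρ≈ρ' (ts i))

  eval-subst : (A : Algebra S) {X Y : Set} (ρ : Y → Carrier A) (σ : X → Term S Y)
    (t : Term S X) →
    _≈_ A (eval S A ρ (subst S σ t)) (eval S A (eval S A ρ ∘ σ) t)
  eval-subst A ρ σ (var x)    = ≈-refl A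
  eval-subst A ρ σ (app f ts) = ⟦⟧-cong A f (λ i → eval-subst A ρ σ (ts i))

  eval-rename : (A : Algebra S) {X Y : Set} (ρ : Y → Carrier A) (r : X → Y) (t : Term S X) →
    _≈_ A (eval S A ρ (rename S r t)) (eval S A (ρ ∘ r) t)
  eval-rename A ρ r = eval-subst A ρ (var ∘ r)

  eval-hom : {A B : Algebra S} (φ : Hom S A B) {X : Set} (ρ : X → Carrier A) (t : Term S X) →
    _≈_ B (fun φ (eval S A ρ t)) (eval S B (fun φ ∘ ρ) t)
  eval-hom {B = B} φ ρ (var x)    = ≈-refl B
  eval-hom {B = B} φ ρ (app f ts) =
    ≈-trans B (homo φ f _) (⟦⟧-cong B f (λ i → eval-hom φ ρ (ts i)))

  Holds-cong : (A : Algebra S) {X : Set} {ρ ρ' : X → Carrier A} →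
    (∀ x → _≈_ A (ρ x) (ρ' x)) → (e : Equation S X) → Holds S A ρ e → Holds S A ρ' e
  Holds-cong A ρ≈ρ' (l , r) l≈r =
    ≈-trans A (≈-sym A (eval-cong A ρ≈ρ' l)) (≈-trans A l≈r (eval-cong A ρ≈ρ' r))

  Holds-rename : (A : Algebra S) {X Y : Set} (ρ : Y → Carrier A) (r : X → Y)
    (e : Equation S X) →
    Holds S A ρ (renameEq S r e) ⇔ Holds S A (ρ ∘ r) e
  Holds-rename A ρ r (l , r') = mk⇔
    (λ H → ≈-trans A (≈-sym A (eval-rename A ρ r l)) (≈-trans A H (eval-rename A ρ r r')))
    (λ H → ≈-trans A (eval-rename A ρ r l) (≈-trans A H (≈-sym A (eval-rename A ρ r r'))))

  All-Holds-rename : (A : Algebra S) {X Y : Set} (ρ : Y → Carrier A) (r : X → Y)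
    (es : List (Equation S X)) →
    All (Holds S A ρ) (map (renameEq S r) es) ⇔ All (Holds S A (ρ ∘ r)) es
  All-Holds-rename A ρ r es = mk⇔
    (λ H → All.map (λ {e} → Equivalence.to (Holds-rename A ρ r e)) (All.map⁻ H))
    (λ H → All.map⁺ (All.map (λ {e} → Equivalence.from (Holds-rename A ρ r e)) H))

  idH : {A : Algebra S} → Hom S A A
  idH {A} = record { fun = id ; fun-cong = id ; homo = λ f as → ≈-refl A }

  infixr 9 _∘H_
  _∘H_ : {A B C : Algebra S} → Hom S B C → Hom S A B → Hom S A C
  _∘H_ {C = C} k h = record
    { fun      = fun k ∘ fun h
    ; fun-cong = fun-cong k ∘ fun-cong h
    ; homo     = λ f as → ≈-trans C (fun-cong k (homo h f as)) (homo k f (fun h ∘ as))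
    }

  Cg-elim : {A B : Algebra S} (φ : Hom S A B) {R : Rel (Carrier A) 0ℓ} →
    R ⇒ ker φ → Cg S A R ⇒ ker φ
  Cg-elim φ R⊆ (gen r)              = R⊆ r
  Cg-elim φ R⊆ (eq a≈b)             = fun-cong φ a≈b
  Cg-elim {B = B} φ R⊆ (sym c)      = ≈-sym B (Cg-elim φ R⊆ c)
  Cg-elim {B = B} φ R⊆ (trans c d)  = ≈-trans B (Cg-elim φ R⊆ c) (Cg-elim φ R⊆ d)
  Cg-elim {B = B} φ R⊆ (cong f {as} {bs} cs) =
    ≈-trans B (homo φ f as)
      (≈-trans B (⟦⟧-cong B f (λ i → Cg-elim φ R⊆ (cs i))) (≈-sym B (homo φ f bs)))

  _/_ : (A : Algebra S) → KCon S A → Algebra S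
  A / L = record
    { Carrier = Carrier A
    ; _≈_     = CgL S A L
    ; isEquiv = record { refl = eq (≈-refl A) ; sym = sym ; trans = trans }
    ; ⟦_⟧     = ⟦ A ⟧
    ; ⟦⟧-cong = cong
    }

  quot : (A : Algebra S) (L : KCon S A) → Hom S A (A / L)
  quot A L = record { fun = id ; fun-cong = eq ; homo = λ f as → eq (≈-refl A) }

  Cg-⊆ : {A : Algebra S} {R : Rel (Carrier A) 0ℓ} {L : KCon S A} →
    R ⇒ CgL S A L → Cg S A R ⇒ CgL S A L
  Cg-⊆ {A} {L = L} = Cg-elim (quot A L)

  lift*-⊆-Δ⇔ : {A B : Algebra S} (h : Hom S A B) (L : KCon S A) →
    (lift* S h (CgL S A L) ⇒ CgL S B []) ⇔ (∀ {a a'} → (a , a') ∈ L → ker h a a')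
  lift*-⊆-Δ⇔ {A} {B} h L = mk⇔ to from
    where
    to : lift* S h (CgL S A L) ⇒ CgL S B [] → ∀ {a a'} → (a , a') ∈ L → ker h a a'
    to H m = Cg-elim idH (λ ()) (H (gen (img (gen m))))

    from : (∀ {a a'} → (a , a') ∈ L → ker h a a') → lift* S h (CgL S A L) ⇒ CgL S B []
    from L⊆ = Cg-⊆ λ { (img c) → eq (Cg-elim h L⊆ c) }

  eval-/ : (A : Algebra S) (L : KCon S A) {X : Set} (ρ : X → Carrier A) (t : Term S X) →
    _≈_ A (eval S (A / L) ρ t) (eval S A ρ t)
  eval-/ A L ρ (var x)    = ≈-refl A
  eval-/ A L ρ (app f ts) = ⟦⟧-cong A f (λ i → eval-/ A L ρ (ts i))

  rightAdjoint-of-compact-preimages : {A B : Algebra S} (h : Hom S A B) →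
    (∀ M → IsCompact A (ker (quot B M ∘H h))) → CompactLiftingHasRightAdjoint S h
  rightAdjoint-of-compact-preimages {A} {B} h preimage = g , λ L M → mk⇔ (to L M) (from L M)
    where
    g : KCon S B → KCon S A
    g M = proj₁ (preimage M)

    to : ∀ L M → lift* S h (CgL S A L) ⇒ CgL S B M → KLe S A L (g M)
    to L M H c = Equivalence.to (proj₂ (preimage M) _ _) (H (gen (img c)))

    from : ∀ L M → KLe S A L (g M) → lift* S h (CgL S A L) ⇒ CgL S B M
    from L M L⊆ = Cg-⊆ λ { (img c) → Equivalence.from (proj₂ (preimage M) _ _) (L⊆ c) }

  ker-compact-of-rightAdjoint : {A B : Algebra S} (h : Hom S A B) →
    CompactLiftingHasRightAdjoint S h → IsCompact A (ker h)
  ker-compact-of-rightAdjoint {A} h (g , adj) = g [] , λ a a' → mk⇔ (to a a') (from a a')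
    where
    to : ∀ a a' → ker h a a' → CgL S A (g []) a a'
    to a a' ha≈ha' = Equivalence.to (adj ((a , a') ∷ []) [])
      (Equivalence.from (lift*-⊆-Δ⇔ h _) (λ { (here ≡.refl) → ha≈ha' }))
      (gen (here ≡.refl))

    from : ∀ a a' → CgL S A (g []) a a' → ker h a a'
    from a a' = Cg-elim h (Equivalence.to (lift*-⊆-Δ⇔ h (g []))
      (Equivalence.from (adj (g []) []) id))

  compact-along-surjection : {A A' B : Algebra S} (p : Hom S A A') → Surjective p →
    (k : Hom S A' B) → IsCompact A (ker (k ∘H p)) → IsCompact A' (ker k)
  compact-along-surjection {A} {A'} {B} p p-onto k (Π , kerΠ) =
    pΠ , λ a a' → mk⇔ (to a a') from
    where
    image : Carrier A × Carrier A → Carrier A' × Carrier A'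
    image (s , s') = fun p s , fun p s'

    pΠ : KCon S A'
    pΠ = map image Π

    pre : Carrier A' → Carrier A
    pre a = proj₁ (p-onto a)

    from : CgL S A' pΠ ⇒ ker k
    from = Cg-elim k λ m → case (∈-map⁻ image m)
      where
      case : ∀ {a a'} → Σ[ e ∈ _ ] (e ∈ Π × (a , a') ≡.≡ image e) → ker k a a'
      case ((s , s') , e∈Π , ≡.refl) = Equivalence.from (kerΠ s s') (gen e∈Π)

    to : ∀ a a' → ker k a a' → CgL S A' pΠ a a'
    to a a' ka≈ka' = trans (eq (≈-sym A' (proj₂ (p-onto a))))
      (trans (Cg-elim (quot A' pΠ ∘H p) (λ m → gen (∈-map⁺ image m))
                (Equivalence.to (kerΠ (pre a) (pre a')) kpre≈))
             (eq (proj₂ (p-onto a'))))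
      where
      open ≈-Reasoning B
      kpre≈ : ker (k ∘H p) (pre a) (pre a')
      kpre≈ = begin
        fun k (fun p (pre a))   ≈⟨ fun-cong k (proj₂ (p-onto a)) ⟩
        fun k a                 ≈⟨ ka≈ka' ⟩
        fun k a'                ≈⟨ fun-cong k (proj₂ (p-onto a')) ⟨
        fun k (fun p (pre a'))  ∎

  module _ (V : Variety {S}) where

    eval-F : {X Y : Set} (σ : Y → Term S X) (t : Term S Y) →
      Derivable V (eval S (F V X) σ t) (subst S σ t)
    eval-F σ (var x)    = refl
    eval-F σ (app f ts) = cong f (λ i → eval-F σ (ts i))

    eval-F-var : {X : Set} (t : Term S X) → Derivable V (eval S (F V X) var t) t
    eval-F-var (var x)    = refl
    eval-F-var (app f ts) = cong f (λ i → eval-F-var (ts i))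

    F∈V : (X : Set) → F V X ∈V V
    F∈V X a σ = trans (eval-F σ (proj₁ (law V a)))
      (trans (axiom a σ) (sym (eval-F σ (proj₂ (law V a)))))

    /-∈V : (A : Algebra S) → A ∈V V → (L : KCon S A) → (A / L) ∈V V
    /-∈V A A∈V L a ρ = trans (eq (eval-/ A L ρ (proj₁ (law V a))))
      (trans (eq (A∈V a ρ)) (sym (eq (eval-/ A L ρ (proj₂ (law V a))))))

    Derivable-sound : (A : Algebra S) → A ∈V V → {X : Set} (ρ : X → Carrier A)
      {s t : Term S X} →
      Derivable V s t → _≈_ A (eval S A ρ s) (eval S A ρ t)
    Derivable-sound A A∈V ρ refl        = ≈-refl A
    Derivable-sound A A∈V ρ (sym d)     = ≈-sym A (Derivable-sound A A∈V ρ d)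
    Derivable-sound A A∈V ρ (trans d e) =
      ≈-trans A (Derivable-sound A A∈V ρ d) (Derivable-sound A A∈V ρ e)
    Derivable-sound A A∈V ρ (cong f ds) = ⟦⟧-cong A f (λ i → Derivable-sound A A∈V ρ (ds i))
    Derivable-sound A A∈V ρ (axiom a σ) =
      ≈-trans A (eval-subst A ρ σ (proj₁ (law V a)))
        (≈-trans A (A∈V a (eval S A ρ ∘ σ))
          (≈-sym A (eval-subst A ρ σ (proj₂ (law V a)))))

    evalH : (A : Algebra S) → A ∈V V → {X : Set} (ρ : X → Carrier A) → Hom S (F V X) A
    evalH A A∈V ρ = record
      { fun = eval S A ρ ; fun-cong = Derivable-sound A A∈V ρ ; homo = λ f as → ≈-refl A }

    renameH : {X Y : Set} (r : X → Y) → Hom S (F V X) (F V Y)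
    renameH {Y = Y} r = record
      { fun      = rename S r
      ; fun-cong = λ {s} {t} d →
          trans (sym (eval-F (var ∘ r) s))
            (trans (Derivable-sound (F V Y) (F∈V Y) (var ∘ r) d) (eval-F (var ∘ r) t))
      ; homo     = λ f as → refl
      }

    free-hom-eval : {X : Set} {A : Algebra S} (p : Hom S (F V X) A) (t : Term S X) →
      _≈_ A (fun p t) (eval S A (fun p ∘ var) t)
    free-hom-eval {A = A} p (var x)    = ≈-refl A
    free-hom-eval {A = A} p (app f ts) =
      ≈-trans A (homo p f ts) (⟦⟧-cong A f (λ i → free-hom-eval p (ts i)))

    ⊨⇔CgL : {X : Set} {L : List (Equation S X)} {s t : Term S X} →
      ⊨ V L ((s , t) ∷ []) ⇔ CgL S (F V X) L s t
    ⊨⇔CgL {X} {L} {s} {t} = mk⇔ complete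
      (λ c C C∈V ρ L-holds → Cg-elim (evalH C C∈V ρ) (All.lookup L-holds) c ∷ [])
      where
      FL : Algebra S
      FL = F V X / L

      eval-var : (u : Term S X) → CgL S (F V X) L (eval S FL var u) u
      eval-var u = trans (eq (eval-/ (F V X) L var u)) (eq (eval-F-var u))

      complete : ⊨ V L ((s , t) ∷ []) → CgL S (F V X) L s t
      complete H with H FL (/-∈V (F V X) (F∈V X) L) var
        (All.tabulate λ { {l , r} m → trans (eval-var l) (trans (gen m) (sym (eval-var r))) })
      ... | s≈t ∷ [] = trans (sym (eval-var s)) (trans s≈t (eval-var t))

    ⊨-trans : {X : Set} {Γ Δ Θ : List (Equation S X)} → ⊨ V Γ Δ → ⊨ V Δ Θ → ⊨ V Γ Θ
    ⊨-trans Γ⊨Δ Δ⊨Θ C C∈V ρ = Δ⊨Θ C C∈V ρ ∘ Γ⊨Δ C C∈V ρ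

    ⊨-∈ : {X : Set} {Γ : List (Equation S X)} {e : Equation S X} → e ∈ Γ → ⊨ V Γ (e ∷ [])
    ⊨-∈ e∈Γ C C∈V ρ Γ-holds = All.lookup Γ-holds e∈Γ ∷ []

    ⊨-map⁺ : {X Y : Set} {Γ : List (Equation S X)} {Δ : List (Equation S Y)}
      (f : Equation S Y → Equation S X) →
      (∀ {e} → e ∈ Δ → ⊨ V Γ (f e ∷ [])) → ⊨ V Γ (map f Δ)
    ⊨-map⁺ f H C C∈V ρ Γ-holds =
      All.map⁺ (All.tabulate λ m → All.head (H m C C∈V ρ Γ-holds))

    ⊨-rename : {X Y : Set} {Γ Δ : List (Equation S X)} (r : X → Y) →
      ⊨ V Γ Δ → ⊨ V (map (renameEq S r) Γ) (map (renameEq S r) Δ)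
    ⊨-rename {Γ = Γ} {Δ} r Γ⊨Δ C C∈V ρ =
      Equivalence.from (All-Holds-rename C ρ r Δ)
      ∘ Γ⊨Δ C C∈V (ρ ∘ r)
      ∘ Equivalence.to (All-Holds-rename C ρ r Γ)

    ⊨-unrename : {X Y : Set} {Γ Δ : List (Equation S X)} (r : X → Y) (r' : Y → X) →
      (∀ x → r' (r x) ≡.≡ x) →
      ⊨ V (map (renameEq S r) Γ) (map (renameEq S r) Δ) → ⊨ V Γ Δ
    ⊨-unrename {Γ = Γ} {Δ} r r' r'∘r≗id H C C∈V ρ =
      All.map (λ {e} → Holds-cong C back e)
      ∘ Equivalence.to (All-Holds-rename C (ρ ∘ r') r Δ)
      ∘ H C C∈V (ρ ∘ r')
      ∘ Equivalence.from (All-Holds-rename C (ρ ∘ r') r Γ)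
      ∘ All.map (λ {e} → Holds-cong C (≈-sym C ∘ back) e)
      where
      back : ∀ x → _≈_ C (ρ (r' (r x))) (ρ x)
      back x = ≈-reflexive C (≡.cong ρ (r'∘r≗id x))

    free-finitePresentation : (n : ℕ) → FinitePresentation V n (F V (Fin n))
    free-finitePresentation n =
      idH , (λ t → t , refl) , [] , λ s t → mk⇔ eq (Cg-elim idH (λ ()))

    module Presentation {n : ℕ} {B : Algebra S} (P : FinitePresentation V n B) where

      q : Hom S (F V (Fin n)) B
      q = proj₁ P

      relations : List (Equation S (Fin n))
      relations = proj₁ (proj₂ (proj₂ P))

      ker⇔relations : ∀ u u' → ker q u u' ⇔ CgL S (F V (Fin n)) relations u u'
      ker⇔relations = proj₂ (proj₂ (proj₂ P))

      word : Carrier B → Term S (Fin n)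
      word b = proj₁ (proj₁ (proj₂ P) b)

      q-word : ∀ b → _≈_ B (fun q (word b)) b
      q-word b = proj₂ (proj₁ (proj₂ P) b)

      relations-hold : All (Holds S B (fun q ∘ var)) relations
      relations-hold = All.tabulate λ { {l , r} m →
        ≈-trans B (≈-sym B (free-hom-eval q l))
          (≈-trans B (Equivalence.from (ker⇔relations l r) (gen m)) (free-hom-eval q r)) }

      module _ (C : Algebra S) (C∈V : C ∈V V) (σ : Fin n → Carrier C)
               (relations-hold-in-C : All (Holds S C σ) relations) where

        ker-sound : ∀ {u u'} → ker q u u' → _≈_ C (eval S C σ u) (eval S C σ u')
        ker-sound = Cg-elim (evalH C C∈V σ) (All.lookup relations-hold-in-C)
          ∘ Equivalence.to (ker⇔relations _ _)

        factor : Hom S B C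
        factor = record
          { fun      = eval S C σ ∘ word
          ; fun-cong = λ {b} {b'} b≈b' →
              ker-sound (≈-trans B (q-word b) (≈-trans B b≈b' (≈-sym B (q-word b'))))
          ; homo     = λ f bs → ker-sound (≈-trans B (q-word _)
              (≈-trans B (⟦⟧-cong B f (λ i → ≈-sym B (q-word (bs i))))
                (≈-sym B (homo q f (word ∘ bs)))))
          }

        factor-q : ∀ u → _≈_ C (fun factor (fun q u)) (eval S C σ u)
        factor-q u = ker-sound (q-word (fun q u))

      word² : Carrier B × Carrier B → Equation S (Fin n)
      word² (b , b') = word b , word b'

      quotient-relations : KCon S B → List (Equation S (Fin n))
      quotient-relations M = relations ++ map word² M

      quotient-relations-hold : (M : KCon S B) →
        (λ u u' → (u , u') ∈ quotient-relations M) ⇒ ker (quot B M ∘H q)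
      quotient-relations-hold M m with ∈-++⁻ relations m
      ... | inj₁ m∈relations = eq (Equivalence.from (ker⇔relations _ _) (gen m∈relations))
      ... | inj₂ m∈words with ∈-map⁻ word² m∈words
      ...   | (b , b') , bb'∈M , ≡.refl =
        trans (eq (q-word b)) (trans (gen bb'∈M) (eq (≈-sym B (q-word b'))))

      quotient-relations-complete : (M : KCon S B) → ∀ {u u'} →
        ker (quot B M ∘H q) u u' → ⊨ V (quotient-relations M) ((u , u') ∷ [])
      quotient-relations-complete M {u} {u'} qu≈qu' C C∈V σ holds
        with All.++⁻ relations holds
      ... | relations-hold-in-C , words-hold =
        ≈-trans C (≈-sym C (φq u)) (≈-trans C (Cg-elim φ kills-M qu≈qu') (φq u')) ∷ []
        where
        φ : Hom S B C
        φ = factor C C∈V σ relations-hold-in-C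

        φq : ∀ u → _≈_ C (fun φ (fun q u)) (eval S C σ u)
        φq = factor-q C C∈V σ relations-hold-in-C

        kills-M : ∀ {b b'} → (b , b') ∈ M → _≈_ C (fun φ b) (fun φ b')
        kills-M {b} {b'} m = begin
          fun φ b                  ≈⟨ fun-cong φ (q-word b) ⟨
          fun φ (fun q (word b))   ≈⟨ φq (word b) ⟩
          eval S C σ (word b)      ≈⟨ All.lookup (All.map⁻ words-hold) m ⟩
          eval S C σ (word b')     ≈⟨ φq (word b') ⟨
          fun φ (fun q (word b'))  ≈⟨ fun-cong φ (q-word b') ⟩
          fun φ b'                 ∎
          where open ≈-Reasoning C

      quotientPresentation : (M : KCon S B) → FinitePresentation V n (B / M)
      quotientPresentation M =
        quot B M ∘H q , (λ b → word b , eq (q-word b)) , quotient-relations M ,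
        λ u u' → mk⇔ (Equivalence.to ⊨⇔CgL ∘ quotient-relations-complete M)
                     (Cg-elim (quot B M ∘H q) (quotient-relations-hold M))

      module _ {m : ℕ} (k : Hom S (F V (Fin m)) B) where

        graphRelations : List (Equation S (Fin n ⊎ Fin m))
        graphRelations =
          map (renameEq S inj₁) relations ++
          map (λ i → var (inj₂ i) , rename S inj₁ (word (fun k (var i)))) (allFin m)

        graphRelations-hold : All (Holds S B [ fun q ∘ var , fun k ∘ var ]) graphRelations
        graphRelations-hold = All.++⁺
          (Equivalence.from (All-Holds-rename B _ inj₁ relations) relations-hold)
          (All.map⁺ (All.tabulate⁺ {f = id} λ i → let w = word (fun k (var i)) in
            ≈-sym B (≈-trans B (eval-rename B _ inj₁ w)
              (≈-trans B (≈-sym B (free-hom-eval q w)) (q-word _)))))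

        ker⊆graphConsequences : ∀ {s s'} → ker k s s' →
          ⊨ V graphRelations (renameEq S inj₂ (s , s') ∷ [])
        ker⊆graphConsequences {s} {s'} ks≈ks' C C∈V ρ holds
          with All.++⁻ (map (renameEq S inj₁) relations) holds
        ... | relations-hold-in-C , words-hold =
          Equivalence.from (Holds-rename C ρ inj₂ (s , s'))
            (≈-trans C (through-B s)
              (≈-trans C (fun-cong φ ks≈ks') (≈-sym C (through-B s')))) ∷ []
          where
          open ≈-Reasoning C
          relations-hold-at-y : All (Holds S C (ρ ∘ inj₁)) relations
          relations-hold-at-y =
            Equivalence.to (All-Holds-rename C ρ inj₁ relations) relations-hold-in-C

          φ : Hom S B C
          φ = factor C C∈V (ρ ∘ inj₁) relations-hold-at-y

          φq : ∀ u → _≈_ C (fun φ (fun q u)) (eval S C (ρ ∘ inj₁) u)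
          φq = factor-q C C∈V (ρ ∘ inj₁) relations-hold-at-y

          x-value : ∀ i → _≈_ C (ρ (inj₂ i)) (fun φ (fun k (var i)))
          x-value i = let w = word (fun k (var i)) in begin
            ρ (inj₂ i)                    ≈⟨ All.lookup (All.map⁻ words-hold) (∈-allFin i) ⟩
            eval S C ρ (rename S inj₁ w)  ≈⟨ eval-rename C ρ inj₁ w ⟩
            eval S C (ρ ∘ inj₁) w         ≈⟨ φq w ⟨
            fun φ (fun q w)               ≈⟨ fun-cong φ (q-word _) ⟩
            fun φ (fun k (var i))         ∎

          through-B : ∀ u → _≈_ C (eval S C (ρ ∘ inj₂) u) (fun φ (fun k u))
          through-B u = begin
            eval S C (ρ ∘ inj₂) u             ≈⟨ eval-cong C x-value u ⟩
            eval S C (fun φ ∘ fun k ∘ var) u  ≈⟨ eval-hom φ (fun k ∘ var) u ⟨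
            fun φ (eval S B (fun k ∘ var) u)  ≈⟨ fun-cong φ (free-hom-eval k u) ⟨
            fun φ (fun k u)                   ∎

        ker⇔graphConsequences : B ∈V V → ∀ s s' →
          ker k s s' ⇔ ⊨ V graphRelations (renameEq S inj₂ (s , s') ∷ [])
        ker⇔graphConsequences B∈V s s' = mk⇔ ker⊆graphConsequences from
          where
          from : ⊨ V graphRelations (renameEq S inj₂ (s , s') ∷ []) → ker k s s'
          from H with H B B∈V [ fun q ∘ var , fun k ∘ var ] graphRelations-hold
          ... | holds ∷ [] = ≈-trans B (free-hom-eval k s)
            (≈-trans B (Equivalence.to (Holds-rename B _ inj₂ (s , s')) holds)
              (≈-sym B (free-hom-eval k s')))

    IsUniformInterpolant : {n m : ℕ} → List (Equation S (Fin n ⊎ Fin m)) →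
      List (Equation S (Fin m)) → Set₁
    IsUniformInterpolant Σ₀ Π =
      ∀ e → ⊨ V Σ₀ (renameEq S inj₂ e ∷ []) ⇔ ⊨ V Π (e ∷ [])

    HasUniformInterpolants : Set₁
    HasUniformInterpolants =
      (n m : ℕ) (Σ₀ : List (Equation S (Fin n ⊎ Fin m))) →
      Σ[ Π ∈ List (Equation S (Fin m)) ] IsUniformInterpolant Σ₀ Π

    ker-compact : HasUniformInterpolants → {na nb : ℕ} {B : Algebra S} → B ∈V V →
      FinitePresentation V nb B → (k : Hom S (F V (Fin na)) B) →
      IsCompact (F V (Fin na)) (ker k)
    ker-compact ui {na} {nb} B∈V P k with ui nb na (Presentation.graphRelations P k)
    ... | Π , Π-uniform = Π , λ s s' →
      ⇔.trans (Presentation.ker⇔graphConsequences P k B∈V s s')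
        (⇔.trans (Π-uniform (s , s')) ⊨⇔CgL)

    deductiveInterpolation-of-rudi : RightUniformDeductiveInterpolation V →
      DeductiveInterpolation V
    deductiveInterpolation-of-rudi rudi n m k Σ₀ ε Σ⊨ε with rudi n m Σ₀
    ... | Π , Σ⊨Π , uniform = Π , Σ⊨Π , uniform k ε Σ⊨ε

    uniformInterpolants-of-rudi : RightUniformDeductiveInterpolation V → HasUniformInterpolants
    uniformInterpolants-of-rudi rudi n m Σ₀ with rudi n m Σ₀
    ... | Π , Σ⊨Π , uniform = Π , λ e → mk⇔
      (λ Σ⊨e → ⊨-unrename inj₁ [ id , (λ ()) ] (λ _ → ≡.refl)
                 (uniform 0 (renameEq S inj₁ e) (weaken e Σ⊨e)))
      (λ Π⊨e → ⊨-trans Σ⊨Π (⊨-rename inj₂ Π⊨e))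
      where
      weaken : ∀ e → ⊨ V Σ₀ (renameEq S inj₂ e ∷ []) →
        ⊨ V (map (renameEq S inj₁) Σ₀)
            (renameEq S [ inj₁ ∘ inj₂ , inj₂ ] (renameEq S inj₁ e) ∷ [])
      weaken e Σ⊨e C C∈V ρ Σ-holds
        with Σ⊨e C C∈V (ρ ∘ inj₁) (Equivalence.to (All-Holds-rename C ρ inj₁ Σ₀) Σ-holds)
      ... | holds ∷ [] =
        Equivalence.from (Holds-rename C ρ [ inj₁ ∘ inj₂ , inj₂ ] (renameEq S inj₁ e))
          (Equivalence.from (Holds-rename C (ρ ∘ [ inj₁ ∘ inj₂ , inj₂ ]) inj₁ e)
            (Equivalence.to (Holds-rename C (ρ ∘ inj₁) inj₂ e) holds)) ∷ []

    rightAdjoints-of-uniformInterpolants : HasUniformInterpolants →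
      CompactLiftingsHaveRightAdjoints V
    rightAdjoints-of-uniformInterpolants ui A B _ B∈V (na , p , p-onto , _) (nb , P) h =
      rightAdjoint-of-compact-preimages h λ M →
        compact-along-surjection p p-onto (quot B M ∘H h)
          (ker-compact ui (/-∈V B B∈V M) (Presentation.quotientPresentation P M)
            (quot B M ∘H h ∘H p))

    uniformInterpolants-of-rightAdjoints : CompactLiftingsHaveRightAdjoints V →
      HasUniformInterpolants
    uniformInterpolants-of-rightAdjoints adjoints n m Σ₀ = Π , λ { (s , s') →
      ⇔.trans (kerQ⇔⊨ s s') (⇔.trans (proj₂ kerQ-compact s s') (⇔.sym ⊨⇔CgL)) }
      where
      Σ'' : List (Equation S (Fin (n + m)))
      Σ'' = map (renameEq S (join n m)) Σ₀

      Q : Algebra S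
      Q = F V (Fin (n + m)) / Σ''

      hQ : Hom S (F V (Fin m)) Q
      hQ = quot _ Σ'' ∘H renameH (join n m) ∘H renameH inj₂

      kerQ-compact : IsCompact (F V (Fin m)) (ker hQ)
      kerQ-compact = ker-compact-of-rightAdjoint hQ
        (adjoints (F V (Fin m)) Q (F∈V (Fin m)) (/-∈V _ (F∈V (Fin (n + m))) Σ'')
          (m , free-finitePresentation m)
          (n + m , Presentation.quotientPresentation (free-finitePresentation (n + m)) Σ'')
          hQ)

      Π : List (Equation S (Fin m))
      Π = proj₁ kerQ-compact

      kerQ⇔⊨ : ∀ s s' → ⊨ V Σ₀ (renameEq S inj₂ (s , s') ∷ []) ⇔ ker hQ s s'
      kerQ⇔⊨ s s' = ⇔.trans
        (mk⇔ (⊨-rename (join n m)) (⊨-unrename (join n m) (splitAt n) (splitAt-join n m)))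
        ⊨⇔CgL

    rudi-of-uniformInterpolants : DeductiveInterpolation V → HasUniformInterpolants →
      RightUniformDeductiveInterpolation V
    rudi-of-uniformInterpolants di ui n m Σ₀ with ui n m Σ₀
    ... | Π , Π-uniform = Π , Σ⊨Π , uniform
      where
      Σ⊨Π : ⊨ V Σ₀ (map (renameEq S inj₂) Π)
      Σ⊨Π = ⊨-map⁺ (renameEq S inj₂) (λ {e} e∈Π → Equivalence.from (Π-uniform e) (⊨-∈ e∈Π))

      -- Π entails every interpolant Π' of Σ and ε, since Σ entails Π'.
      uniform : (k : ℕ) (ε : Equation S (Fin m ⊎ Fin k)) →
        ⊨ V (map (renameEq S inj₁) Σ₀) (renameEq S [ inj₁ ∘ inj₂ , inj₂ ] ε ∷ []) →
        ⊨ V (map (renameEq S inj₁) Π) (ε ∷ [])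
      uniform k ε Σ⊨ε with di n m k Σ₀ ε Σ⊨ε
      ... | Π' , Σ⊨Π' , Π'⊨ε = ⊨-trans
        (⊨-map⁺ (renameEq S inj₁) λ {e} e∈Π' → ⊨-rename inj₁
          (Equivalence.to (Π-uniform e)
            (⊨-trans Σ⊨Π' (⊨-∈ (∈-map⁺ (renameEq S inj₂) e∈Π')))))
        Π'⊨ε

-- Algebras may be empty here.
theorem3p2 : (S : Signature) → HasConstant S → (V : Variety {S}) →
    RightUniformDeductiveInterpolation V
      ⇔ (DeductiveInterpolation V × CompactLiftingsHaveRightAdjoints V)
theorem3p2 S _ V = mk⇔
  (λ rudi →
     deductiveInterpolation-of-rudi V rudi
   , rightAdjoints-of-uniformInterpolants V (uniformInterpolants-of-rudi V rudi))
  (λ (di , adjoints) →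
     rudi-of-uniformInterpolants V di (uniformInterpolants-of-rightAdjoints V adjoints))
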